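{- Let $n=3$ or $n\ge 5$. There is no bijection $f:V(G_1)\to V(G_2)$, where $G_1,G_2$ are disjoint copies of the cycle $C_n$, such that $\gamma(C(C_n,f))=\gamma(C_n)$.
   Context: For disjoint copies $G_1,G_2$ of a graph $G$ and a function $f:V(G_1)\to V(G_2)$, the functigraph $C(G,f)$ has vertex set $V(G_1)\cup V(G_2)$ and edge set $E(G_1)\cup E(G_2)\cup\{uv : u\in V(G_1), v\in V(G_2), v=f(u)\}$. $\gamma$ denotes domination number. -}

module Defs where

open import Data.Nat using (ℕ; zero; suc)
open import Data.Fin using (Fin; toℕ)
open import Data.Sum using (_⊎_; inj₁; inj₂)
open import Data.Product using (_×_; ∃-syntax)
open import Data.List using (List; length)
open import Data.List.Membership.Propositional using (_∈_)
open import Data.List.Relation.Unary.Unique.Propositional using (Unique)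
open import Data.Empty using (⊥)
open import Relation.Binary.PropositionalEquality using (_≡_)

record Graph : Set₁ where
  field
    V   : Set
    Adj : V → V → Set
open Graph public

record IsDominatingSet (G : Graph) (D : List (V G)) : Set where
  field
    unique    : Unique D
    dominates : ∀ v → v ∈ D ⊎ (∃[ u ] (u ∈ D × Adj G u v))

record DominationNumber (G : Graph) (k : ℕ) : Set where
  field
    witness    : List (V G)
    witness-ds : IsDominatingSet G witness
    witness-sz : length witness ≡ k
    minimal    : ∀ D → IsDominatingSet G D → k Data.Nat.≤ length D

CycleAdj : (n : ℕ) → Fin n → Fin n → Set
CycleAdj n i j =
  (toℕ j ≡ suc (toℕ i)) ⊎ (toℕ i ≡ suc (toℕ j))
  ⊎ ((toℕ i ≡ 0) × (suc (toℕ j) ≡ n)) ⊎ ((toℕ j ≡ 0) × (suc (toℕ i) ≡ n))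

Cycle : ℕ → Graph
Cycle n = record { V = Fin n ; Adj = CycleAdj n }

FAdj : (G : Graph) → (V G → V G) → (V G ⊎ V G) → (V G ⊎ V G) → Set
FAdj G f (inj₁ a) (inj₁ b) = Adj G a b
FAdj G f (inj₂ a) (inj₂ b) = Adj G a b
FAdj G f (inj₁ u) (inj₂ v) = v ≡ f u
FAdj G f (inj₂ v) (inj₁ u) = v ≡ f u

Functigraph : (G : Graph) → (V G → V G) → Graph
Functigraph G f = record { V = V G ⊎ V G ; Adj = FAdj G f }

-- A vertex of the functigraph C(C_n, f) with f injective has at most three
-- neighbours: its two cycle neighbours and at most one vertex of the other copy.
-- So every dominating set of its 2n vertices has at least 2n/4 = n/2 elements,
-- while the vertices 0, 3, 6, … dominate C_n, giving γ(C_n) ≤ ⌈n/3⌉ < n/2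
-- exactly when n = 3 or n ≥ 5.
module Submission where

open import Defs
open import Data.Nat using (ℕ; zero; suc; _+_; _*_; _≤_; _<_; _≥_; s≤s)
open import Data.Nat.Properties
  using (<-irrefl; suc-injective; ≤-refl; n≤1+n; m≤m+n; m≤n⇒m≤1+n; *-suc; *-comm; *-distribʳ-+; *-monoʳ-≤; +-mono-<; module ≤-Reasoning)
open import Data.Fin using (Fin; toℕ; _↑ʳ_; combine)
import Data.Fin.Properties as Finₚ
open import Data.Fin.Properties using (toℕ<n; toℕ-injective; ↑ʳ-injective; combine-injective; injective⇒≤; +↔⊎)
open import Data.Sum using (_⊎_; inj₁; inj₂)
open import Data.Product using (_×_; _,_; ∃-syntax)
open import Data.List using (List; []; _∷_; map; length)
open import Data.List.Properties using (length-map)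
open import Data.List.Membership.Propositional using (_∈_)
open import Data.List.Membership.Propositional.Properties using (∈-map⁺)
open import Data.List.Membership.Setoid.Properties using (index-injective)
open import Data.List.Relation.Unary.Any using (here; there; index)
open import Data.List.Relation.Unary.All using (All; []; _∷_)
open import Data.List.Relation.Unary.AllPairs using ([]; _∷_)
open import Data.List.Relation.Unary.Unique.Propositional using (Unique)
import Data.List.Relation.Unary.Unique.Propositional.Properties as Unique
open import Data.Empty using (⊥-elim)
open import Function.Base using (_∘_)
open import Function.Bundles using (Injection; _↣_)
open import Function.Properties.Inverse using (↔⇒↣)
open import Function.Definitions using (Bijective; Injective)
open import Relation.Nullary using (¬_)
open import Relation.Binary.PropositionalEquality using (_≡_; refl; sym; trans; cong; subst)
open import Relation.Binary.PropositionalEquality.Properties using (setoid)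

-- Every vertex has at most d neighbours, witnessed by injectively labelling them.
record PortNumbering (G : Graph) (d : ℕ) : Set where
  field
    port           : ∀ u v → Adj G u v → Fin d
    port-injective : ∀ u {v v′} (p : Adj G u v) (q : Adj G u v′) → port u v p ≡ port u v′ q → v ≡ v′
open PortNumbering

ClosedAdj : (G : Graph) → V G → V G → Set
ClosedAdj G u v = v ≡ u ⊎ Adj G u v

module _ {G : Graph} {d : ℕ} (P : PortNumbering G d) where

  closedPort : ∀ {u v} → ClosedAdj G u v → Fin (suc d)
  closedPort         (inj₁ _) = Fin.zero
  closedPort {u} {v} (inj₂ p) = Fin.suc (port P u v p)

  closedPort-injective : ∀ {u v v′} (p : ClosedAdj G u v) (q : ClosedAdj G u v′) →
                         closedPort p ≡ closedPort q → v ≡ v′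
  closedPort-injective     (inj₁ refl) (inj₁ refl) _  = refl
  closedPort-injective {u} (inj₂ p)    (inj₂ q)    eq = port-injective P u p q (Finₚ.suc-injective eq)

  -- Each vertex is coded by the position of a dominator in D and its closed port there.
  dominatingSet-size : ∀ {N} → Fin N ↣ V G → ∀ {D} → IsDominatingSet G D → N ≤ length D * suc d
  dominatingSet-size vertices {D} ds =
    injective⇒≤ {f = encode ∘ dominator ∘ Injection.to vertices}
      (λ eq → Injection.injective vertices (encode-injective _ _ eq))
    where
    Dominated : V G → Set
    Dominated v = ∃[ u ] (u ∈ D × ClosedAdj G u v)

    dominator : ∀ v → Dominated v
    dominator v with IsDominatingSet.dominates ds v
    ... | inj₁ v∈D           = v , v∈D , inj₁ refl
    ... | inj₂ (u , u∈D , a) = u , u∈D , inj₂ a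

    encode : ∀ {v} → Dominated v → Fin (length D * suc d)
    encode (_ , u∈D , a) = combine (index u∈D) (closedPort a)

    encode-injective : ∀ {v v′} (x : Dominated v) (y : Dominated v′) → encode x ≡ encode y → v ≡ v′
    encode-injective (u , u∈D , a) (u′ , u′∈D , a′) eq
      with same-index , same-port ← combine-injective (index u∈D) (closedPort a) (index u′∈D) (closedPort a′) eq
      with refl ← index-injective (setoid _) u∈D u′∈D same-index
      = closedPort-injective a a′ same-port

IsSucc : (n : ℕ) → Fin n → Fin n → Set
IsSucc n i j = (toℕ j ≡ suc (toℕ i)) ⊎ ((toℕ j ≡ 0) × (suc (toℕ i) ≡ n))

cycleAdj⇒succ⊎pred : ∀ {n i j} → CycleAdj n i j → IsSucc n i j ⊎ IsSucc n j i
cycleAdj⇒succ⊎pred (inj₁ e)                = inj₁ (inj₁ e)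
cycleAdj⇒succ⊎pred (inj₂ (inj₁ e))         = inj₂ (inj₁ e)
cycleAdj⇒succ⊎pred (inj₂ (inj₂ (inj₁ e)))  = inj₂ (inj₂ e)
cycleAdj⇒succ⊎pred (inj₂ (inj₂ (inj₂ e)))  = inj₁ (inj₂ e)

succ-functional : ∀ {n i j j′} → IsSucc n i j → IsSucc n i j′ → j ≡ j′
succ-functional (inj₁ e)           (inj₁ e′)            = toℕ-injective (trans e (sym e′))
succ-functional {j = j} (inj₁ e)   (inj₂ (_ , last))    = ⊥-elim (<-irrefl (trans e last) (toℕ<n j))
succ-functional {j′ = j′} (inj₂ (_ , last)) (inj₁ e′)   = ⊥-elim (<-irrefl (trans e′ last) (toℕ<n j′))
succ-functional (inj₂ (e , _))     (inj₂ (e′ , _))      = toℕ-injective (trans e (sym e′))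

succ-injective : ∀ {n i i′ j} → IsSucc n i j → IsSucc n i′ j → i ≡ i′
succ-injective (inj₁ e)       (inj₁ e′)       = toℕ-injective (suc-injective (trans (sym e) e′))
succ-injective (inj₁ e)       (inj₂ (e′ , _)) with () ← trans (sym e) e′
succ-injective (inj₂ (e , _)) (inj₁ e′)       with () ← trans (sym e) e′
succ-injective (inj₂ (_ , s)) (inj₂ (_ , s′)) = toℕ-injective (suc-injective (trans s (sym s′)))

cycle-ports : ∀ n → PortNumbering (Cycle n) 2
cycle-ports n = record
  { port           = λ _ _ a → side (cycleAdj⇒succ⊎pred a)
  ; port-injective = λ _ p q → side-injective (cycleAdj⇒succ⊎pred p) (cycleAdj⇒succ⊎pred q)
  }
  where
  side : ∀ {A B : Set} → A ⊎ B → Fin 2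
  side (inj₁ _) = Fin.zero
  side (inj₂ _) = Fin.suc Fin.zero

  side-injective : ∀ {i j j′} (p : IsSucc n i j ⊎ IsSucc n j i) (q : IsSucc n i j′ ⊎ IsSucc n j′ i) →
                   side p ≡ side q → j ≡ j′
  side-injective (inj₁ s) (inj₁ s′) _ = succ-functional s s′
  side-injective (inj₂ s) (inj₂ s′) _ = succ-injective s s′

functigraph-ports : ∀ {G d} (f : V G → V G) → Injective _≡_ _≡_ f →
                    PortNumbering G d → PortNumbering (Functigraph G f) (suc d)
functigraph-ports {G} {d} f f-injective P = record { port = port′ ; port-injective = injective }
  where
  port′ : ∀ u v → FAdj G f u v → Fin (suc d)
  port′ (inj₁ a) (inj₁ b) p = Fin.suc (port P a b p)
  port′ (inj₂ a) (inj₂ b) p = Fin.suc (port P a b p)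
  port′ (inj₁ _) (inj₂ _) _ = Fin.zero
  port′ (inj₂ _) (inj₁ _) _ = Fin.zero

  injective : ∀ u {v v′} (p : FAdj G f u v) (q : FAdj G f u v′) → port′ u v p ≡ port′ u v′ q → v ≡ v′
  injective (inj₁ a) {inj₁ _} {inj₁ _} p q eq = cong inj₁ (port-injective P a p q (Finₚ.suc-injective eq))
  injective (inj₂ a) {inj₂ _} {inj₂ _} p q eq = cong inj₂ (port-injective P a p q (Finₚ.suc-injective eq))
  injective (inj₁ _) {inj₂ _} {inj₂ _} p q _  = cong inj₂ (trans p (sym q))
  injective (inj₂ _) {inj₁ _} {inj₁ _} p q _  = cong inj₁ (f-injective (trans (sym p) q))
  injective (inj₁ _) {inj₁ _} {inj₂ _} _ _ ()
  injective (inj₁ _) {inj₂ _} {inj₁ _} _ _ ()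
  injective (inj₂ _) {inj₁ _} {inj₂ _} _ _ ()
  injective (inj₂ _) {inj₂ _} {inj₁ _} _ _ ()

⌈_/3⌉ : ℕ → ℕ
⌈ zero /3⌉                   = 0
⌈ suc zero /3⌉               = 1
⌈ suc (suc zero) /3⌉         = 1
⌈ suc (suc (suc n)) /3⌉      = suc ⌈ n /3⌉

everyThird : (n : ℕ) → List (Fin n)
everyThird zero                = []
everyThird (suc zero)          = Fin.zero ∷ []
everyThird (suc (suc zero))    = Fin.zero ∷ []
everyThird (suc (suc (suc n))) = Fin.zero ∷ map (3 ↑ʳ_) (everyThird n)

length-everyThird : ∀ n → length (everyThird n) ≡ ⌈ n /3⌉
length-everyThird zero                = refl
length-everyThird (suc zero)          = refl
length-everyThird (suc (suc zero))    = refl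
length-everyThird (suc (suc (suc n))) =
  cong suc (trans (length-map (3 ↑ʳ_) (everyThird n)) (length-everyThird n))

zero∈everyThird : ∀ n → Fin.zero ∈ everyThird (suc n)
zero∈everyThird zero          = here refl
zero∈everyThird (suc zero)    = here refl
zero∈everyThird (suc (suc n)) = here refl

everyThird-unique : ∀ n → Unique (everyThird n)
everyThird-unique zero                = []
everyThird-unique (suc zero)          = [] ∷ []
everyThird-unique (suc (suc zero))    = [] ∷ []
everyThird-unique (suc (suc (suc n))) =
  zero∉ (everyThird n) ∷ Unique.map⁺ (↑ʳ-injective 3 _ _) (everyThird-unique n)
  where
  zero∉ : ∀ xs → All (λ y → ¬ Fin.zero ≡ y) (map (_↑ʳ_ {n} 3) xs)
  zero∉ []       = []
  zero∉ (_ ∷ xs) = (λ ()) ∷ zero∉ xs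

-- Domination of C_n by everyThird n without the wrap-around edge, except that
-- the last vertex may be left over (it is dominated through the edge n-1 ~ 0).
DominatedOnPath : (n : ℕ) → Fin n → Set
DominatedOnPath n j =
  j ∈ everyThird n
  ⊎ (∃[ u ] (u ∈ everyThird n × toℕ j ≡ suc (toℕ u)))
  ⊎ (∃[ u ] (u ∈ everyThird n × toℕ u ≡ suc (toℕ j)))
  ⊎ (suc (toℕ j) ≡ n)

↑ʳ-∈-everyThird : ∀ {n} {x : Fin n} → x ∈ everyThird n → 3 ↑ʳ x ∈ everyThird (3 + n)
↑ʳ-∈-everyThird x∈ = there (∈-map⁺ (3 ↑ʳ_) x∈)

dominatedOnPath : ∀ n (j : Fin n) → DominatedOnPath n j
dominatedOnPath (suc n) Fin.zero = inj₁ (zero∈everyThird n)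
dominatedOnPath (suc (suc n)) (Fin.suc Fin.zero) = inj₂ (inj₁ (Fin.zero , zero∈everyThird (suc n) , refl))
dominatedOnPath (suc (suc (suc zero))) (Fin.suc (Fin.suc Fin.zero)) = inj₂ (inj₂ (inj₂ refl))
dominatedOnPath (suc (suc (suc (suc n)))) (Fin.suc (Fin.suc Fin.zero)) =
  inj₂ (inj₂ (inj₁ (3 ↑ʳ Fin.zero , ↑ʳ-∈-everyThird (zero∈everyThird n) , refl)))
dominatedOnPath (suc (suc (suc n))) (Fin.suc (Fin.suc (Fin.suc j))) with dominatedOnPath n j
... | inj₁ j∈                            = inj₁ (↑ʳ-∈-everyThird j∈)
... | inj₂ (inj₁ (u , u∈ , e))          = inj₂ (inj₁ (3 ↑ʳ u , ↑ʳ-∈-everyThird u∈ , cong (3 +_) e))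
... | inj₂ (inj₂ (inj₁ (u , u∈ , e)))   = inj₂ (inj₂ (inj₁ (3 ↑ʳ u , ↑ʳ-∈-everyThird u∈ , cong (3 +_) e)))
... | inj₂ (inj₂ (inj₂ e))              = inj₂ (inj₂ (inj₂ (cong (3 +_) e)))

everyThird-dominating : ∀ n → IsDominatingSet (Cycle n) (everyThird n)
everyThird-dominating n = record { unique = everyThird-unique n ; dominates = dominates n }
  where
  dominates : ∀ n (j : Fin n) → j ∈ everyThird n ⊎ ∃[ u ] (u ∈ everyThird n × CycleAdj n u j)
  dominates (suc n) j with dominatedOnPath (suc n) j
  ... | inj₁ j∈                          = inj₁ j∈
  ... | inj₂ (inj₁ (u , u∈ , e))         = inj₂ (u , u∈ , inj₁ e)
  ... | inj₂ (inj₂ (inj₁ (u , u∈ , e)))  = inj₂ (u , u∈ , inj₂ (inj₁ e))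
  ... | inj₂ (inj₂ (inj₂ last))          = inj₂ (Fin.zero , zero∈everyThird n , inj₂ (inj₂ (inj₁ (refl , last))))

twice-⌈/3⌉<-self : ∀ n → n ≡ 3 ⊎ n ≥ 5 → 2 * ⌈ n /3⌉ < n
twice-⌈/3⌉<-self 3 (inj₁ refl) = ≤-refl
twice-⌈/3⌉<-self _ (inj₂ (s≤s (s≤s (s≤s (s≤s (s≤s {n = m} _)))))) = from-5 m
  where
  from-5 : ∀ m → 2 * ⌈ 5 + m /3⌉ < 5 + m
  from-5 0 = ≤-refl
  from-5 1 = n≤1+n 5
  from-5 2 = ≤-refl
  from-5 (suc (suc (suc m))) =
    subst (_< 8 + m) (sym (*-suc 2 ⌈ 5 + m /3⌉)) (s≤s (s≤s (m≤n⇒m≤1+n (from-5 m))))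

corollary3p4 : (n : ℕ) → (n ≡ 3 ⊎ n ≥ 5) →
    ¬ (∃[ f ] (Bijective _≡_ _≡_ f × (∃[ k ] (DominationNumber (Cycle n) k
        × DominationNumber (Functigraph (Cycle n) f) k))))
corollary3p4 n n≡3⊎n≥5 (f , (f-injective , _) , k , γ-cycle , γ-functigraph) = <-irrefl refl (begin-strict
  n + n                        ≤⟨ functigraph-size ⟩
  k * 4                        ≡⟨ *-comm k 4 ⟩
  4 * k                        ≤⟨ *-monoʳ-≤ 4 cycle-size ⟩
  4 * ⌈ n /3⌉                  ≡⟨ *-distribʳ-+ ⌈ n /3⌉ 2 2 ⟩
  2 * ⌈ n /3⌉ + 2 * ⌈ n /3⌉    <⟨ +-mono-< 2⌈n/3⌉<n 2⌈n/3⌉<n ⟩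
  n + n                        ∎)
  where
  open DominationNumber
  open ≤-Reasoning

  cycle-size : k ≤ ⌈ n /3⌉
  cycle-size = subst (k ≤_) (length-everyThird n) (minimal γ-cycle (everyThird n) (everyThird-dominating n))

  functigraph-size : n + n ≤ k * 4
  functigraph-size = subst (λ m → n + n ≤ m * 4) (witness-sz γ-functigraph)
    (dominatingSet-size (functigraph-ports f f-injective (cycle-ports n))
      (↔⇒↣ +↔⊎) (witness-ds γ-functigraph))

  2⌈n/3⌉<n : 2 * ⌈ n /3⌉ < n
  2⌈n/3⌉<n = twice-⌈/3⌉<-self n n≡3⊎n≥5
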